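{- We have $|\mathcal{P}_n(132,3412)| = 3\cdot 2^{n-2}-1$ for all $n\ge 2$; $|\mathcal{P}_n(132,45123)| = 3\cdot 2^{n-1} - F_{n+3}+1$ for all $n\ge 1$; $|\mathcal{P}_n(132,561234)| = 3\cdot 2^{n} - 1 - \frac{6}{5}F_{n+1} - \frac{n+1}{5}\left(F_{n+4}+F_{n+2}\right)$ for all $n\ge 1$.
   Context: $S_n$ is the set of permutations of $\{1,\dots,n\}$ in one-line notation. A permutation avoids a pattern $\sigma\in S_k$ if it has no subsequence of length $k$ whose entries are in the same relative order as $\sigma$. $\mathcal{P}_n(132,\tau)$ is the set of permutations in $S_n$ avoiding each of $132$, $2341$, $3241$ and $\tau$ (equivalently, the two-stack sortable permutations avoiding $132$ and $\tau$). The Fibonacci numbers are $F_0=0$, $F_1=1$, $F_n=F_{n-1}+F_{n-2}$ for $n\ge 2$. -}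

module Defs where

open import Data.Nat using (ℕ; zero; suc; _+_; _<_)
open import Data.Fin using (Fin; cast)
open import Data.List using (List; []; _∷_; length; lookup; upTo; map)
open import Data.List.Relation.Binary.Sublist.Propositional using (_⊆_)
open import Data.List.Relation.Binary.Permutation.Propositional using (_↭_)
open import Data.List.Relation.Unary.Unique.Propositional using (Unique)
open import Data.List.Membership.Propositional using (_∈_)
open import Data.Product using (Σ; ∃-syntax; _×_)
open import Relation.Binary.PropositionalEquality using (_≡_)
open import Relation.Nullary using (¬_)
open import Function.Bundles using (_⇔_)

F : ℕ → ℕ
F zero = 0
F (suc zero) = 1
F (suc (suc n)) = F (suc n) + F n

-- A word w (one-line notation) is a permutation in S_n iff it is a
-- rearrangement of the list [1, 2, ..., n].
IsPerm : ℕ → List ℕ → Set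
IsPerm n w = w ↭ map suc (upTo n)

OrderIso : List ℕ → List ℕ → Set
OrderIso u σ = Σ (length u ≡ length σ) λ eq →
  ∀ (i j : Fin (length u)) →
    (lookup u i < lookup u j) ⇔ (lookup σ (cast eq i) < lookup σ (cast eq j))

Contains : List ℕ → List ℕ → Set
Contains w σ = ∃[ u ] (u ⊆ w × OrderIso u σ)

Avoids : List ℕ → List ℕ → Set
Avoids w σ = ¬ Contains w σ

-- membership in P_n(132, τ): permutations of S_n avoiding 132, 2341, 3241, τ
InP : ℕ → List ℕ → List ℕ → Set
InP n τ w = IsPerm n w × Avoids w (1 ∷ 3 ∷ 2 ∷ []) × Avoids w (2 ∷ 3 ∷ 4 ∷ 1 ∷ [])
          × Avoids w (3 ∷ 2 ∷ 4 ∷ 1 ∷ []) × Avoids w τ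

HasSize : (List ℕ → Set) → ℕ → Set
HasSize P k = ∃[ L ] (Unique L × (∀ w → (w ∈ L) ⇔ P w) × length L ≡ k)

{-# OPTIONS --safe #-}
-- In a permutation w ∈ P_{m+1}(132) (avoiding 132, 2341 and 3241) the maximum m+1 splits w as
-- α (m+1) β; avoiding 132 puts every entry of α above every entry of β, and then avoiding 2341
-- and 3241 leaves only three shapes: α (m+1), (m+1) β and m (m+1) β with β ∈ P_{m-1}(132).
-- An occurrence of a pattern in such a word either lies in α or β, or uses the new large
-- entries, which forces a large entry at the corresponding place of the pattern. Hence
-- avoiding τ_k = (k+1)(k+2)12…k is inherited unchanged in the first two shapes and becomes
-- avoiding 12…k in the third, while for 12…k appending the maximum lowers k by one. This gives
-- recurrences for the number of avoiders of 12…k and of τ_k, solved by induction with the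
-- Fibonacci recurrence.
module Submission where

open import Defs
open import Data.Nat using (ℕ; zero; suc; _+_; _*_; _∸_; _^_; _≤_; _<_; _<?_; z≤n; s≤s)
open import Data.Nat.Properties
  using ( <-cmp; <-trans; <-irrefl; <-asym; ≤-refl; ≤⇒≯; n<1+n; suc-injective
        ; +-identityʳ; +-comm; +-cancelʳ-≡; *-assoc; m+n∸n≡m; *-distribˡ-∸)
open import Data.Nat.Tactic.RingSolver using (solve-∀)
open import Data.Fin using (cast) renaming (zero to fzero; suc to fsuc)
open import Data.List using (List; []; _∷_; _∷ʳ_; _++_; length; lookup; map; upTo)
import Data.List.Properties as List
open import Data.List.Relation.Binary.Sublist.Propositional
  using (_⊆_; []; _∷_; ⊆-refl; ⊆-trans; minimum; from∈)
  renaming (_∷ʳ_ to _∷ˢ_)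
open import Data.List.Relation.Binary.Sublist.Propositional.Properties
  using (++⁺; ++⁺ˡ; ++⁺ʳ; All-resp-⊆)
open import Data.List.Relation.Unary.All as All using (All; []; _∷_)
open import Data.List.Relation.Unary.Any using (here; there)
open import Data.List.Relation.Unary.Unique.Propositional using (Unique)
open import Data.List.Relation.Unary.AllPairs using ([]; _∷_)
import Data.List.Relation.Unary.All.Properties as All
import Data.List.Relation.Unary.Unique.Propositional.Properties as Unique
open import Data.List.Membership.Propositional using (_∈_)
open import Data.List.Membership.Propositional.Properties
  using (∈-map⁺; ∈-map⁻; ∈-upTo⁺; ∈-upTo⁻; ∈-∃++; ∈-++⁺ˡ; ∈-++⁺ʳ; ∈-++⁻)
open import Data.List.Relation.Binary.Permutation.Propositional
  using (_↭_; prep; swap; ↭-refl; ↭-sym; ↭-trans; ↭⇒↭ₛ)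
open import Data.List.Relation.Binary.Permutation.Propositional.Properties
  using (∈-resp-↭; drop-mid; ∷↭∷ʳ; ¬x∷xs↭[]; ↭-empty-inv) renaming (++⁺ʳ to ↭-++⁺ʳ)
import Data.List.Relation.Binary.Permutation.Setoid.Properties as PermutationSetoid
open import Data.Product using (∃-syntax; _×_; _,_; proj₁; proj₂)
open import Data.Sum as Sum using (_⊎_; inj₁; inj₂; [_,_]′)
open import Data.Unit using (⊤; tt)
open import Data.Empty using (⊥; ⊥-elim)
open import Function.Bundles using (_⇔_; mk⇔; Equivalence)
open import Function.Construct.Composition using (_⇔-∘_)
open import Function.Construct.Symmetry using (⇔-sym)
open Equivalence using (to; from)
open import Relation.Binary using (tri<; tri≈; tri>)
open import Relation.Binary.PropositionalEquality
  using (_≡_; _≢_; refl; sym; trans; cong; cong₂; subst; setoid; module ≡-Reasoning)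
open import Relation.Nullary using (¬_)
open import Relation.Nullary.Decidable using (from-no)

-- Order isomorphism through comparisons

-- Comparisons are computed rather than proved, so that similarity to a concrete pattern
-- reduces by evaluation.
data Comparison : Set where
  lt eq gt : Comparison

compare : ℕ → ℕ → Comparison
compare zero    zero    = eq
compare zero    (suc _) = lt
compare (suc _) zero    = gt
compare (suc m) (suc n) = compare m n

opposite : Comparison → Comparison
opposite lt = gt
opposite eq = eq
opposite gt = lt

compare-swap : ∀ m n → compare n m ≡ opposite (compare m n)
compare-swap zero    zero    = refl
compare-swap zero    (suc n) = refl
compare-swap (suc m) zero    = refl
compare-swap (suc m) (suc n) = compare-swap m n

compare-refl : ∀ n → compare n n ≡ eq
compare-refl zero    = refl
compare-refl (suc n) = compare-refl n

compare≡lt⇒< : ∀ {m n} → compare m n ≡ lt → m < n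
compare≡lt⇒< {zero}  {suc n} _ = s≤s z≤n
compare≡lt⇒< {suc m} {suc n} e = s≤s (compare≡lt⇒< e)

<⇒compare≡lt : ∀ {m n} → m < n → compare m n ≡ lt
<⇒compare≡lt {zero}  (s≤s _) = refl
<⇒compare≡lt {suc m} (s≤s p) = <⇒compare≡lt p

compare≡gt⇒> : ∀ {m n} → compare m n ≡ gt → n < m
compare≡gt⇒> {m} {n} e = compare≡lt⇒< (trans (compare-swap m n) (cong opposite e))

>⇒compare≡gt : ∀ {m n} → n < m → compare m n ≡ gt
>⇒compare≡gt {m} {n} p = trans (compare-swap n m) (cong opposite (<⇒compare≡lt p))

compare-swap-cong : ∀ {m n m′ n′} → compare m n ≡ compare m′ n′ → compare n m ≡ compare n′ m′
compare-swap-cong {m} {n} {m′} {n′} e =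
  trans (compare-swap m n) (trans (cong opposite e) (sym (compare-swap m′ n′)))

compare-cong : ∀ {m n m′ n′} → (m < n ⇔ m′ < n′) → (n < m ⇔ n′ < m′) → compare m n ≡ compare m′ n′
compare-cong {m} {n} {m′} {n′} p q with <-cmp m n | <-cmp m′ n′
... | tri< a _ _ | tri< b _ _ = trans (<⇒compare≡lt a) (sym (<⇒compare≡lt b))
... | tri≈ _ refl _ | tri≈ _ refl _ = trans (compare-refl m) (sym (compare-refl m′))
... | tri> _ _ a | tri> _ _ b = trans (>⇒compare≡gt a) (sym (>⇒compare≡gt b))
... | tri< a _ _ | tri≈ ¬b _ _ = ⊥-elim (¬b (to p a))
... | tri< a _ _ | tri> ¬b _ _ = ⊥-elim (¬b (to p a))
... | tri≈ ¬a _ _ | tri< b _ _ = ⊥-elim (¬a (from p b))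
... | tri> ¬a _ _ | tri< b _ _ = ⊥-elim (¬a (from p b))
... | tri≈ _ _ ¬a | tri> _ _ b = ⊥-elim (¬a (from q b))
... | tri> _ _ a | tri≈ _ _ ¬b = ⊥-elim (¬b (to q a))

compare⇒<-⇔ : ∀ {m n m′ n′} → compare m n ≡ compare m′ n′ → (m < n ⇔ m′ < n′)
compare⇒<-⇔ e = mk⇔ (λ p → compare≡lt⇒< (trans (sym e) (<⇒compare≡lt p)))
                     (λ p → compare≡lt⇒< (trans e (<⇒compare≡lt p)))

Aligned : ℕ → List ℕ → ℕ → List ℕ → Set
Aligned x []      y []      = ⊤
Aligned x (a ∷ u) y (b ∷ v) = compare x a ≡ compare y b × Aligned x u y v
Aligned _ _       _ _       = ⊥

Similar : List ℕ → List ℕ → Set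
Similar []      []      = ⊤
Similar (x ∷ u) (y ∷ v) = Aligned x u y v × Similar u v
Similar _       _       = ⊥

Similar-length : ∀ u v → Similar u v → length u ≡ length v
Similar-length []      []      _       = refl
Similar-length (_ ∷ u) (_ ∷ v) (_ , s) = cong suc (Similar-length u v s)

Aligned⇒compare-lookup : ∀ x u y v (e : length u ≡ length v) → Aligned x u y v →
  ∀ j → compare x (lookup u j) ≡ compare y (lookup v (cast e j))
Aligned⇒compare-lookup x (_ ∷ u) y (_ ∷ v) e (c , _) fzero    = c
Aligned⇒compare-lookup x (_ ∷ u) y (_ ∷ v) e (_ , a) (fsuc j) =
  Aligned⇒compare-lookup x u y v (suc-injective e) a j

compare-lookup⇒Aligned : ∀ x u y v (e : length u ≡ length v) →
  (∀ j → compare x (lookup u j) ≡ compare y (lookup v (cast e j))) → Aligned x u y v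
compare-lookup⇒Aligned x []      y []      e f = tt
compare-lookup⇒Aligned x (_ ∷ u) y (_ ∷ v) e f =
  f fzero , compare-lookup⇒Aligned x u y v (suc-injective e) (λ j → f (fsuc j))

Similar⇒compare-lookup : ∀ u v (s : Similar u v) → let e = Similar-length u v s in
  ∀ i j → compare (lookup u i) (lookup u j) ≡ compare (lookup v (cast e i)) (lookup v (cast e j))
Similar⇒compare-lookup (x ∷ u) (y ∷ v) (a , s) fzero    fzero    = trans (compare-refl x) (sym (compare-refl y))
Similar⇒compare-lookup (x ∷ u) (y ∷ v) (a , s) fzero    (fsuc j) =
  Aligned⇒compare-lookup x u y v (Similar-length u v s) a j
Similar⇒compare-lookup (x ∷ u) (y ∷ v) (a , s) (fsuc i) fzero    =
  compare-swap-cong {x} {m′ = y} (Aligned⇒compare-lookup x u y v (Similar-length u v s) a i)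
Similar⇒compare-lookup (x ∷ u) (y ∷ v) (a , s) (fsuc i) (fsuc j) = Similar⇒compare-lookup u v s i j

compare-lookup⇒Similar : ∀ u v (e : length u ≡ length v) →
  (∀ i j → compare (lookup u i) (lookup u j) ≡ compare (lookup v (cast e i)) (lookup v (cast e j))) → Similar u v
compare-lookup⇒Similar []      []      e f = tt
compare-lookup⇒Similar (x ∷ u) (y ∷ v) e f =
  compare-lookup⇒Aligned x u y v (suc-injective e) (λ j → f fzero (fsuc j)) ,
  compare-lookup⇒Similar u v (suc-injective e) (λ i j → f (fsuc i) (fsuc j))

OrderIso⇔Similar : ∀ {u v} → OrderIso u v ⇔ Similar u v
OrderIso⇔Similar {u} {v} = mk⇔
  (λ (e , f) → compare-lookup⇒Similar u v e (λ i j → compare-cong (f i j) (f j i)))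
  (λ s → Similar-length u v s , λ i j → compare⇒<-⇔ (Similar⇒compare-lookup u v s i j))

Embeds : List ℕ → List ℕ → Set
Embeds w σ = ∃[ u ] (u ⊆ w × Similar u σ)

Contains⇔Embeds : ∀ {w σ} → Contains w σ ⇔ Embeds w σ
Contains⇔Embeds = mk⇔ (λ (u , p , i) → u , p , to OrderIso⇔Similar i)
                      (λ (u , p , s) → u , p , from OrderIso⇔Similar s)

Aligned-sym : ∀ {x y} u v → Aligned x u y v → Aligned y v x u
Aligned-sym []      []      _        = tt
Aligned-sym (_ ∷ u) (_ ∷ v) (c , al) = sym c , Aligned-sym u v al

Similar-sym : ∀ u v → Similar u v → Similar v u
Similar-sym []      []      _         = tt
Similar-sym (_ ∷ u) (_ ∷ v) (al , si) = Aligned-sym u v al , Similar-sym u v si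

Aligned-below : ∀ {x y} u v → All (_< x) u → Aligned x u y v → All (_< y) v
Aligned-below []      []      _        _        = []
Aligned-below (_ ∷ u) (_ ∷ v) (p ∷ ps) (c , al) =
  compare≡gt⇒> (trans (sym c) (>⇒compare≡gt p)) ∷ Aligned-below u v ps al

below⇒Aligned : ∀ {x y} u v → All (_< x) u → All (_< y) v → length u ≡ length v → Aligned x u y v
below⇒Aligned []      []      _        _        _ = tt
below⇒Aligned (_ ∷ u) (_ ∷ v) (p ∷ ps) (q ∷ qs) e =
  trans (>⇒compare≡gt p) (sym (>⇒compare≡gt q)) , below⇒Aligned u v ps qs (suc-injective e)

Aligned-∷ʳ⁻ : ∀ {x y} u a v → Aligned x (u ∷ʳ a) y v →
  ∃[ v′ ] ∃[ b ] (v ≡ v′ ∷ʳ b × Aligned x u y v′ × compare x a ≡ compare y b)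
Aligned-∷ʳ⁻ []      a (b ∷ [])    (c , _) = [] , b , refl , tt , c
Aligned-∷ʳ⁻ []      a (_ ∷ _ ∷ _) (_ , ())
Aligned-∷ʳ⁻ (_ ∷ u) a (b ∷ v)     (c , al) with Aligned-∷ʳ⁻ u a v al
... | v′ , b′ , refl , al′ , c′ = b ∷ v′ , b′ , refl , (c , al′) , c′

Aligned-∷ʳ⁺ : ∀ {x y} u a v b → Aligned x u y v → compare x a ≡ compare y b → Aligned x (u ∷ʳ a) y (v ∷ʳ b)
Aligned-∷ʳ⁺ []      a []      b _        c′ = c′ , tt
Aligned-∷ʳ⁺ (_ ∷ u) a (_ ∷ v) b (c , al) c′ = c , Aligned-∷ʳ⁺ u a v b al c′

Similar-∷ʳ⁻ : ∀ u x σ → Similar (u ∷ʳ x) σ → ∃[ σ′ ] ∃[ t ] (σ ≡ σ′ ∷ʳ t × Similar u σ′ × Aligned x u t σ′)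
Similar-∷ʳ⁻ []      x (t ∷ [])    _  = [] , t , refl , tt , tt
Similar-∷ʳ⁻ []      x (_ ∷ _ ∷ _) (() , _)
Similar-∷ʳ⁻ (a ∷ u) x (s ∷ σ)     (al , si) with Similar-∷ʳ⁻ u x σ si
... | σ′ , t , refl , si′ , al′ with Aligned-∷ʳ⁻ u x (σ′ ∷ʳ t) al
... | τ , t′ , e , al″ , c with List.∷ʳ-injective σ′ τ e
... | refl , refl = s ∷ σ′ , t , refl , (al″ , si′) , (compare-swap-cong {a} {x} {s} {t} c , al′)

Similar-∷ʳ⁺ : ∀ u x σ t → Similar u σ → Aligned x u t σ → Similar (u ∷ʳ x) (σ ∷ʳ t)
Similar-∷ʳ⁺ []      x []      t _         _        = tt , tt
Similar-∷ʳ⁺ (a ∷ u) x (s ∷ σ) t (al , si) (c , al′) =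
  Aligned-∷ʳ⁺ u x σ t al (compare-swap-cong {x} {a} {t} {s} c) , Similar-∷ʳ⁺ u x σ t si al′

Similar-∷ʳ-init : ∀ u σ t → Similar u (σ ∷ʳ t) → ∃[ u′ ] ∃[ x ] (u ≡ u′ ∷ʳ x × Similar u′ σ)
Similar-∷ʳ-init u σ t si with Similar-∷ʳ⁻ σ t u (Similar-sym u _ si)
... | u′ , x , refl , si′ , _ = u′ , x , refl , Similar-sym σ u′ si′

⊆-∷ʳ⁻ : ∀ {u} (w : List ℕ) x → u ⊆ w ∷ʳ x → u ⊆ w ⊎ ∃[ u′ ] (u ≡ u′ ∷ʳ x × u′ ⊆ w)
⊆-∷ʳ⁻ []      x (.x ∷ˢ []) = inj₁ []
⊆-∷ʳ⁻ []      x (refl ∷ []) = inj₂ ([] , refl , [])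
⊆-∷ʳ⁻ (a ∷ w) x (.a ∷ˢ p) with ⊆-∷ʳ⁻ w x p
... | inj₁ q               = inj₁ (a ∷ˢ q)
... | inj₂ (u′ , refl , q) = inj₂ (u′ , refl , a ∷ˢ q)
⊆-∷ʳ⁻ (a ∷ w) x (refl ∷ p) with ⊆-∷ʳ⁻ w x p
... | inj₁ q               = inj₁ (refl ∷ q)
... | inj₂ (u′ , refl , q) = inj₂ (a ∷ u′ , refl , refl ∷ q)

Embeds-⊆ : ∀ {β w σ} → β ⊆ w → Embeds β σ → Embeds w σ
Embeds-⊆ p (u , q , si) = u , ⊆-trans q p , si

Embeds-tail : ∀ {w s σ} → Embeds w (s ∷ σ) → Embeds w σ
Embeds-tail ((x ∷ u) , p , (_ , si)) = u , ⊆-trans (x ∷ˢ ⊆-refl) p , si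

Embeds-init : ∀ {w σ t} → Embeds w (σ ∷ʳ t) → Embeds w σ
Embeds-init {σ = σ} {t} (u , p , si) with Similar-∷ʳ-init u σ t si
... | u′ , x , refl , si′ = u′ , ⊆-trans (++⁺ʳ (x ∷ []) ⊆-refl) p , si′

Embeds-[] : ∀ w → Embeds w []
Embeds-[] w = [] , minimum w , tt

Embeds-singleton : ∀ {a w y} → Embeds (a ∷ w) (y ∷ [])
Embeds-singleton {a} {w} = a ∷ [] , refl ∷ minimum w , tt , tt

Embeds-prependMax⁻ : ∀ {N β s σ} → All (_< N) β → Embeds (N ∷ β) (s ∷ σ) → Embeds β (s ∷ σ) ⊎ All (_< s) σ
Embeds-prependMax⁻ _ (u , (_ ∷ˢ p) , si) = inj₁ (u , p , si)
Embeds-prependMax⁻ {σ = σ} bound ((_ ∷ u) , (refl ∷ p) , (al , _)) =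
  inj₂ (Aligned-below u σ (All-resp-⊆ p bound) al)

Embeds-appendMax⁻ : ∀ {N α σ} → All (_< N) α → Embeds (α ∷ʳ N) σ →
  Embeds α σ ⊎ ∃[ σ′ ] ∃[ t ] (σ ≡ σ′ ∷ʳ t × All (_< t) σ′ × Embeds α σ′)
Embeds-appendMax⁻ {N} {α} {σ} bound (u , p , si) with ⊆-∷ʳ⁻ α N p
... | inj₁ q = inj₁ (u , q , si)
... | inj₂ (u′ , refl , q) with Similar-∷ʳ⁻ u′ N σ si
... | σ′ , t , refl , si′ , al = inj₂ (σ′ , t , refl , Aligned-below u′ σ′ (All-resp-⊆ q bound) al , (u′ , q , si′))

Embeds-appendMax⁺ : ∀ {N α σ t} → All (_< N) α → All (_< t) σ → Embeds α σ → Embeds (α ∷ʳ N) (σ ∷ʳ t)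
Embeds-appendMax⁺ {N} {α} {σ} {t} bound top (u , p , si) =
  u ∷ʳ N , ++⁺ p ⊆-refl ,
  Similar-∷ʳ⁺ u N σ t si (below⇒Aligned u σ (All-resp-⊆ p bound) top (Similar-length u σ si))

Embeds-prependPair⁻ : ∀ {M N β s₁ s₂ σ} → M < N → All (_< M) β → Embeds (M ∷ N ∷ β) (s₁ ∷ s₂ ∷ σ) →
  Embeds β (s₁ ∷ s₂ ∷ σ) ⊎ All (_< s₁) (s₂ ∷ σ) ⊎ (All (_< s₁) σ × Embeds β σ)
Embeds-prependPair⁻ _ _ (u , (_ ∷ˢ (_ ∷ˢ p)) , si) = inj₁ (u , p , si)
Embeds-prependPair⁻ {s₂ = s₂} {σ} M<N bound ((_ ∷ u) , (_ ∷ˢ (refl ∷ p)) , (al , _)) =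
  inj₂ (inj₁ (Aligned-below u (s₂ ∷ σ) (All-resp-⊆ p (All.map (λ b<M → <-trans b<M M<N) bound)) al))
Embeds-prependPair⁻ {s₂ = s₂} {σ} _ bound ((_ ∷ u) , (refl ∷ (_ ∷ˢ p)) , (al , _)) =
  inj₂ (inj₁ (Aligned-below u (s₂ ∷ σ) (All-resp-⊆ p bound) al))
Embeds-prependPair⁻ {σ = σ} _ bound ((_ ∷ _ ∷ u) , (refl ∷ (refl ∷ p)) , ((_ , al) , (_ , si))) =
  inj₂ (inj₂ (Aligned-below u σ (All-resp-⊆ p bound) al , (u , p , si)))

Embeds-prependPair⁺ : ∀ {M N β s₁ s₂ σ} → M < N → All (_< M) β → s₁ < s₂ → All (_< s₁) σ →
  Embeds β σ → Embeds (M ∷ N ∷ β) (s₁ ∷ s₂ ∷ σ)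
Embeds-prependPair⁺ {M} {N} {β} {s₁} {s₂} {σ} M<N bound s₁<s₂ top (u , p , si) =
  M ∷ N ∷ u , refl ∷ refl ∷ p ,
  ((trans (<⇒compare≡lt M<N) (sym (<⇒compare≡lt s₁<s₂)) , below⇒Aligned u σ u-below-M top len) ,
   (below⇒Aligned u σ (All.map (λ b<M → <-trans b<M M<N) u-below-M)
                      (All.map (λ b<s₁ → <-trans b<s₁ s₁<s₂) top) len , si))
  where
  u-below-M = All-resp-⊆ p bound
  len = Similar-length u σ si

-- Occurrences of a pattern after adding a new maximum

AppendMaxReduces : List ℕ → List ℕ → Set
AppendMaxReduces σ σ′ = ∀ {N α} → All (_< N) α → Embeds (α ∷ʳ N) σ ⇔ Embeds α σ′

PrependMaxPreserves : List ℕ → Set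
PrependMaxPreserves σ = ∀ {N β} → All (_< N) β → Embeds (N ∷ β) σ ⇔ Embeds β σ

PrependPairReduces : List ℕ → List ℕ → Set
PrependPairReduces σ σ′ = ∀ {M β} → All (_< M) β → Embeds (M ∷ suc M ∷ β) σ ⇔ Embeds β σ′

LastIsNotMax : List ℕ → Set
LastIsNotMax σ = ∀ {σ′ t} → σ ≡ σ′ ∷ʳ t → ¬ All (_< t) σ′

LastIsNotMax-∷ʳ : ∀ {σ t} → ¬ All (_< t) σ → LastIsNotMax (σ ∷ʳ t)
LastIsNotMax-∷ʳ {σ} ¬top {σ′} e with refl , refl ← List.∷ʳ-injective σ σ′ e = ¬top

HeadIsNotMax : List ℕ → Set
HeadIsNotMax []      = ⊥
HeadIsNotMax (s ∷ σ) = ¬ All (_< s) σ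

appendMax-reduces-self : ∀ {σ} → LastIsNotMax σ → AppendMaxReduces σ σ
appendMax-reduces-self {σ} ¬max {N} {α} bound = mk⇔ drop-max (Embeds-⊆ (++⁺ʳ (N ∷ []) ⊆-refl))
  where
  drop-max : Embeds (α ∷ʳ N) σ → Embeds α σ
  drop-max e with Embeds-appendMax⁻ bound e
  ... | inj₁ e′                     = e′
  ... | inj₂ (_ , _ , σ≡ , top , _) = ⊥-elim (¬max σ≡ top)

appendMax-reduces-init : ∀ {σ t} → All (_< t) σ → AppendMaxReduces (σ ∷ʳ t) σ
appendMax-reduces-init {σ} {t} top {N} {α} bound = mk⇔ drop-max (Embeds-appendMax⁺ bound top)
  where
  drop-max : Embeds (α ∷ʳ N) (σ ∷ʳ t) → Embeds α σ
  drop-max e with Embeds-appendMax⁻ bound e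
  ... | inj₁ e′                      = Embeds-init e′
  ... | inj₂ (σ′ , _ , σ≡ , _ , e′) with refl , refl ← List.∷ʳ-injective σ σ′ σ≡ = e′

prependMax-preserves : ∀ {σ} → HeadIsNotMax σ → PrependMaxPreserves σ
prependMax-preserves {s ∷ σ} ¬max {N} {β} bound = mk⇔ drop-max (Embeds-⊆ (N ∷ˢ ⊆-refl))
  where
  drop-max : Embeds (N ∷ β) (s ∷ σ) → Embeds β (s ∷ σ)
  drop-max e with Embeds-prependMax⁻ bound e
  ... | inj₁ e′ = e′
  ... | inj₂ top = ⊥-elim (¬max top)

prependPair-reduces-self : ∀ {s₁ s₂ σ} → ¬ All (_< s₁) σ → PrependPairReduces (s₁ ∷ s₂ ∷ σ) (s₁ ∷ s₂ ∷ σ)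
prependPair-reduces-self {s₁} {s₂} {σ} ¬top {M} {β} bound = mk⇔ drop-pair (Embeds-⊆ (M ∷ˢ (suc M ∷ˢ ⊆-refl)))
  where
  drop-pair : Embeds (M ∷ suc M ∷ β) (s₁ ∷ s₂ ∷ σ) → Embeds β (s₁ ∷ s₂ ∷ σ)
  drop-pair e with Embeds-prependPair⁻ ≤-refl bound e
  ... | inj₁ e′                = e′
  ... | inj₂ (inj₁ (_ ∷ top))  = ⊥-elim (¬top top)
  ... | inj₂ (inj₂ (top , _))  = ⊥-elim (¬top top)

prependPair-reduces-tail : ∀ {s₁ s₂ σ} → s₁ < s₂ → All (_< s₁) σ → PrependPairReduces (s₁ ∷ s₂ ∷ σ) σ
prependPair-reduces-tail {s₁} {s₂} {σ} s₁<s₂ top {M} {β} bound =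
  mk⇔ drop-pair (Embeds-prependPair⁺ ≤-refl bound s₁<s₂ top)
  where
  drop-pair : Embeds (M ∷ suc M ∷ β) (s₁ ∷ s₂ ∷ σ) → Embeds β σ
  drop-pair e with Embeds-prependPair⁻ ≤-refl bound e
  ... | inj₁ e′                  = Embeds-tail (Embeds-tail e′)
  ... | inj₂ (inj₁ (s₂<s₁ ∷ _)) = ⊥-elim (<-asym s₁<s₂ s₂<s₁)
  ... | inj₂ (inj₂ (_ , e′))     = e′

-- Both sides always hold: M (M+1) is an occurrence of 12, and every word contains the empty pattern.
prependPair-reduces-12 : PrependPairReduces (1 ∷ 2 ∷ []) []
prependPair-reduces-12 {M} {β} _ = mk⇔
  (λ _ → Embeds-[] β)
  (λ _ → M ∷ suc M ∷ [] , refl ∷ refl ∷ minimum β , ((<⇒compare≡lt (n<1+n M) , tt) , (tt , tt)))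

Avoids-⇔ : ∀ {w σ w′ σ′} → Embeds w σ ⇔ Embeds w′ σ′ → Avoids w σ ⇔ Avoids w′ σ′
Avoids-⇔ e = mk⇔
  (λ av c → av (from Contains⇔Embeds (from e (to Contains⇔Embeds c))))
  (λ av c → av (from Contains⇔Embeds (to e (to Contains⇔Embeds c))))

Avoids⇒¬Embeds : ∀ {w σ} → Avoids w σ → ¬ Embeds w σ
Avoids⇒¬Embeds av e = av (from Contains⇔Embeds e)

Avoids-⊆ : ∀ {β w σ} → β ⊆ w → Avoids w σ → Avoids β σ
Avoids-⊆ p av (u , q , i) = av (u , ⊆-trans q p , i)

[1⋯_] : ℕ → List ℕ
[1⋯ n ] = map suc (upTo n)

[1⋯]-∷ʳ : ∀ n → [1⋯ suc n ] ≡ [1⋯ n ] ∷ʳ suc n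
[1⋯]-∷ʳ n = trans (cong (map suc) (sym (List.upTo-∷ʳ n))) (List.map-++ suc (upTo n) (n ∷ []))

∈-[1⋯]⁻ : ∀ {x n} → x ∈ [1⋯ n ] → 1 ≤ x × x ≤ n
∈-[1⋯]⁻ x∈ with _ , i∈ , refl ← ∈-map⁻ suc x∈ = s≤s z≤n , ∈-upTo⁻ i∈

∈-[1⋯]⁺ : ∀ {i n} → i < n → suc i ∈ [1⋯ n ]
∈-[1⋯]⁺ i<n = ∈-map⁺ suc (∈-upTo⁺ i<n)

IsPerm-∈ : ∀ {n w x} → IsPerm n w → x ∈ w → 1 ≤ x × x ≤ n
IsPerm-∈ p x∈ = ∈-[1⋯]⁻ (∈-resp-↭ p x∈)

IsPerm-below : ∀ {n w} → IsPerm n w → All (_< suc n) w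
IsPerm-below p = All.tabulate (λ x∈ → s≤s (proj₂ (IsPerm-∈ p x∈)))

IsPerm-max∈ : ∀ {n w} → IsPerm (suc n) w → suc n ∈ w
IsPerm-max∈ {n} p = ∈-resp-↭ (↭-sym p) (∈-[1⋯]⁺ (n<1+n n))

IsPerm⇒Unique : ∀ {n w} → IsPerm n w → Unique w
IsPerm⇒Unique {n} p = PermutationSetoid.Unique-resp-↭ (setoid ℕ) (↭⇒↭ₛ (↭-sym p)) (Unique.map⁺ suc-injective (Unique.upTo⁺ n))

IsPerm-∷ʳ : ∀ {n α} → IsPerm n α → IsPerm (suc n) (α ∷ʳ suc n)
IsPerm-∷ʳ {n} {α} p = subst (α ∷ʳ suc n ↭_) (sym ([1⋯]-∷ʳ n)) (↭-++⁺ʳ (suc n ∷ []) p)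

IsPerm-∷ : ∀ {n β} → IsPerm n β → IsPerm (suc n) (suc n ∷ β)
IsPerm-∷ {n} {β} p = subst (suc n ∷ β ↭_) (sym ([1⋯]-∷ʳ n)) (↭-trans (prep (suc n) p) (∷↭∷ʳ (suc n) [1⋯ n ]))

IsPerm-∷∷ : ∀ {n β} → IsPerm n β → IsPerm (suc (suc n)) (suc n ∷ suc (suc n) ∷ β)
IsPerm-∷∷ p = ↭-trans (swap _ _ ↭-refl) (IsPerm-∷ (IsPerm-∷ p))

IsPerm-remove-max : ∀ {n} α {β} → IsPerm (suc n) (α ++ suc n ∷ β) → IsPerm n (α ++ β)
IsPerm-remove-max {n} α {β} p =
  subst (α ++ β ↭_) (List.++-identityʳ [1⋯ n ]) (drop-mid α [1⋯ n ] (subst (α ++ suc n ∷ β ↭_) ([1⋯]-∷ʳ n) p))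

IsPerm-nonempty : ∀ {n} → ¬ IsPerm (suc n) []
IsPerm-nonempty p = ¬x∷xs↭[] (↭-sym p)

Unique-++⇒≢ : ∀ α {β : List ℕ} {a b} → Unique (α ++ β) → a ∈ α → b ∈ β → a ≢ b
Unique-++⇒≢ (_ ∷ α) (a≢ ∷ _) (here refl) b∈ = All.lookup (All.++⁻ʳ α a≢) b∈
Unique-++⇒≢ (_ ∷ α) (_ ∷ u)  (there a∈)  b∈ = Unique-++⇒≢ α u a∈ b∈

Avoids-appendMax : ∀ {σ σ′ n α} → AppendMaxReduces σ σ′ → IsPerm n α → Avoids (α ∷ʳ suc n) σ ⇔ Avoids α σ′
Avoids-appendMax r p = Avoids-⇔ (r (IsPerm-below p))

Avoids-prependMax : ∀ {σ n β} → PrependMaxPreserves σ → IsPerm n β → Avoids (suc n ∷ β) σ ⇔ Avoids β σ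
Avoids-prependMax r p = Avoids-⇔ (r (IsPerm-below p))

Avoids-prependPair : ∀ {σ σ′ n β} → PrependPairReduces σ σ′ → IsPerm n β →
  Avoids (suc n ∷ suc (suc n) ∷ β) σ ⇔ Avoids β σ′
Avoids-prependPair r p = Avoids-⇔ (r (IsPerm-below p))

HasSize-resp : ∀ {P Q k} → (∀ w → P w ⇔ Q w) → HasSize P k → HasSize Q k
HasSize-resp P⇔Q (L , u , mem , len) = L , u , (λ w → P⇔Q w ⇔-∘ mem w) , len

HasSize-∅ : ∀ {P} → (∀ w → ¬ P w) → HasSize P 0
HasSize-∅ ¬P = [] , [] , (λ w → mk⇔ (λ ()) (λ p → ⊥-elim (¬P w p))) , refl

HasSize-singleton : ∀ {P} x → (∀ w → P w ⇔ w ≡ x) → HasSize P 1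
HasSize-singleton x P⇔≡x =
  x ∷ [] , [] ∷ [] , (λ w → mk⇔ (λ { (here refl) → from (P⇔≡x x) refl }) (λ p → here (to (P⇔≡x w) p))) , refl

HasSize-⊎ : ∀ {P Q a b} → (∀ {w} → P w → ¬ Q w) → HasSize P a → HasSize Q b → HasSize (λ w → P w ⊎ Q w) (a + b)
HasSize-⊎ disjoint (L , u , mem , refl) (L′ , u′ , mem′ , refl) =
  L ++ L′ ,
  Unique.++⁺ u u′ (λ (w∈L , w∈L′) → disjoint (to (mem _) w∈L) (to (mem′ _) w∈L′)) ,
  (λ w → mk⇔ (λ w∈ → Sum.map (to (mem w)) (to (mem′ w)) (∈-++⁻ L w∈))
             [ (λ p → ∈-++⁺ˡ (from (mem w) p)) , (λ q → ∈-++⁺ʳ L (from (mem′ w) q)) ]′) ,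
  List.length-++ L

HasSize-image : ∀ {P a} {f : List ℕ → List ℕ} → (∀ {u v} → f u ≡ f v → u ≡ v) → HasSize P a →
  HasSize (λ w → ∃[ v ] (w ≡ f v × P v)) a
HasSize-image {f = f} injective (L , u , mem , refl) =
  map f L , Unique.map⁺ injective u ,
  (λ w → mk⇔ (λ w∈ → let (v , v∈ , w≡) = ∈-map⁻ f w∈ in v , w≡ , to (mem v) v∈)
             (λ (v , w≡ , p) → subst (_∈ map f L) (sym w≡) (∈-map⁺ f (from (mem v) p)))) ,
  List.length-map f L

-- The decomposition of P_{m+1}

Sortable132 : ℕ → List ℕ → Set
Sortable132 n w = IsPerm n w × Avoids w (1 ∷ 3 ∷ 2 ∷ []) × Avoids w (2 ∷ 3 ∷ 4 ∷ 1 ∷ []) × Avoids w (3 ∷ 2 ∷ 4 ∷ 1 ∷ [])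

InP⇔Sortable132×Avoids : ∀ {n τ w} → InP n τ w ⇔ (Sortable132 n w × Avoids w τ)
InP⇔Sortable132×Avoids = mk⇔ (λ (p , a₁ , a₂ , a₃ , a) → (p , a₁ , a₂ , a₃) , a)
                             (λ ((p , a₁ , a₂ , a₃) , a) → p , a₁ , a₂ , a₃ , a)

Sortable132-⊆ : ∀ {n k u w} → u ⊆ w → IsPerm k u → Sortable132 n w → Sortable132 k u
Sortable132-⊆ u⊆w p (_ , a₁ , a₂ , a₃) = p , Avoids-⊆ u⊆w a₁ , Avoids-⊆ u⊆w a₂ , Avoids-⊆ u⊆w a₃

-- For a property P of permutations, the three ways of building an element of S_{m+1} from
-- smaller ones: m+1 appended to α ∈ S_m (m ≥ 1), m+1 prepended to β ∈ S_m, and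
-- m (m+1) prepended to β ∈ S_{m-1} (m ≥ 2).
Appended : (ℕ → List ℕ → Set) → ℕ → List ℕ → Set
Appended P zero    w = ⊥
Appended P (suc m) w = ∃[ α ] (w ≡ α ∷ʳ suc (suc m) × P (suc m) α)

Prepended : (ℕ → List ℕ → Set) → ℕ → List ℕ → Set
Prepended P m w = ∃[ β ] (w ≡ suc m ∷ β × P m β)

PairPrepended : (ℕ → List ℕ → Set) → ℕ → List ℕ → Set
PairPrepended P (suc (suc m)) w = ∃[ β ] (w ≡ suc (suc m) ∷ suc (suc (suc m)) ∷ β × P (suc m) β)
PairPrepended P _             w = ⊥

Shapes : (ℕ → List ℕ → Set) → (ℕ → List ℕ → Set) → (ℕ → List ℕ → Set) → ℕ → List ℕ → Set
Shapes P Q R m w = Appended P m w ⊎ Prepended Q m w ⊎ PairPrepended R m w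

Appended-disjoint-Prepended : ∀ {P Q m w} → (∀ {n v} → P n v → IsPerm n v) →
  Appended P m w → ¬ Prepended Q m w
Appended-disjoint-Prepended {m = suc m} perm ([] , refl , pα)    _          = IsPerm-nonempty (perm pα)
Appended-disjoint-Prepended {m = suc m} perm (_ ∷ _ , refl , pα) (_ , refl , _) =
  <-irrefl refl (All.head (IsPerm-below (perm pα)))

Appended-disjoint-PairPrepended : ∀ {P R m w} → (∀ {n v} → P n v → IsPerm n v) → (∀ {n v} → R n v → IsPerm n v) →
  Appended P m w → ¬ PairPrepended R m w
Appended-disjoint-PairPrepended {m = suc (suc m)} permP _ ([] , refl , pα) _ = IsPerm-nonempty (permP pα)
Appended-disjoint-PairPrepended {m = suc (suc m)} _ permR (_ ∷ [] , refl , _) (_ , refl , rβ) =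
  IsPerm-nonempty (permR rβ)
Appended-disjoint-PairPrepended {m = suc (suc m)} permP _ (_ ∷ _ ∷ _ , refl , pα) (_ , refl , _) =
  <-irrefl refl (All.head (All.tail (IsPerm-below (permP pα))))

Prepended-disjoint-PairPrepended : ∀ {Q R m w} → Prepended Q m w → ¬ PairPrepended R m w
Prepended-disjoint-PairPrepended {m = suc (suc m)} (_ , refl , _) (_ , () , _)

prefix-above-suffix : ∀ {N} α {β} → Avoids (α ++ N ∷ β) (1 ∷ 3 ∷ 2 ∷ []) → Unique (α ++ β) →
  All (_< N) (α ++ β) → ∀ {a b} → a ∈ α → b ∈ β → b < a
prefix-above-suffix {N} α {β} av unique bound {a} {b} a∈ b∈ with <-cmp a b
... | tri> _ _ b<a = b<a
... | tri≈ _ a≡b _ = ⊥-elim (Unique-++⇒≢ α unique a∈ b∈ a≡b)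
... | tri< a<b _ _ = ⊥-elim (Avoids⇒¬Embeds av (a ∷ N ∷ b ∷ [] , ++⁺ (from∈ a∈) (refl ∷ from∈ b∈) ,
        ((<⇒compare≡lt a<N , <⇒compare≡lt a<b , tt) , (>⇒compare≡gt b<N , tt) , tt , tt)))
  where
  a<N = All.lookup bound (∈-++⁺ˡ a∈)
  b<N = All.lookup bound (∈-++⁺ʳ α b∈)

similar-2341-or-3241 : ∀ {a₁ a₂ N b} → a₁ ≢ a₂ → a₁ < N → a₂ < N → b < a₁ → b < a₂ →
  Similar (a₁ ∷ a₂ ∷ N ∷ b ∷ []) (2 ∷ 3 ∷ 4 ∷ 1 ∷ []) ⊎ Similar (a₁ ∷ a₂ ∷ N ∷ b ∷ []) (3 ∷ 2 ∷ 4 ∷ 1 ∷ [])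
similar-2341-or-3241 {a₁} {a₂} a₁≢a₂ a₁<N a₂<N b<a₁ b<a₂ with <-cmp a₁ a₂
... | tri< a₁<a₂ _ _ = inj₁ ((<⇒compare≡lt a₁<a₂ , <⇒compare≡lt a₁<N , >⇒compare≡gt b<a₁ , tt) ,
                              (<⇒compare≡lt a₂<N , >⇒compare≡gt b<a₂ , tt) , (>⇒compare≡gt (<-trans b<a₁ a₁<N) , tt) , tt , tt)
... | tri≈ _ a₁≡a₂ _ = ⊥-elim (a₁≢a₂ a₁≡a₂)
... | tri> _ _ a₂<a₁ = inj₂ ((>⇒compare≡gt a₂<a₁ , <⇒compare≡lt a₁<N , >⇒compare≡gt b<a₁ , tt) ,
                              (<⇒compare≡lt a₂<N , >⇒compare≡gt b<a₂ , tt) , (>⇒compare≡gt (<-trans b<a₁ a₁<N) , tt) , tt , tt)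

single-before-max : ∀ {m a b β} → Sortable132 (suc (suc m)) (a ∷ suc (suc m) ∷ b ∷ β) →
  IsPerm (suc m) (a ∷ b ∷ β) → (∀ {x} → x ∈ b ∷ β → x < a) →
  PairPrepended Sortable132 (suc m) (a ∷ suc (suc m) ∷ b ∷ β)
single-before-max {m} s p above with IsPerm-max∈ p
... | there m∈ = ⊥-elim (≤⇒≯ (proj₂ (IsPerm-∈ p (here refl))) (above m∈))
single-before-max {zero}  s p above | here refl = ⊥-elim (≤⇒≯ (proj₁ (IsPerm-∈ p (there (here refl)))) (above (here refl)))
single-before-max {suc m} s p above | here refl =
  _ , refl , Sortable132-⊆ (_ ∷ˢ (_ ∷ˢ ⊆-refl)) (IsPerm-remove-max [] p) s

no-two-before-max : ∀ {m a₁ a₂ α b β} → Sortable132 (suc m) (a₁ ∷ a₂ ∷ α ++ suc m ∷ b ∷ β) →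
  IsPerm m (a₁ ∷ a₂ ∷ α ++ b ∷ β) → b < a₁ → b < a₂ → ⊥
no-two-before-max {α = α} {β = β} (_ , _ , av₂₃₄₁ , av₃₂₄₁) p b<a₁ b<a₂
  with IsPerm⇒Unique p | IsPerm-below p
... | (a₁≢a₂ ∷ _) ∷ _ | a₁<N ∷ a₂<N ∷ _ with similar-2341-or-3241 a₁≢a₂ a₁<N a₂<N b<a₁ b<a₂
... | inj₁ sim = Avoids⇒¬Embeds av₂₃₄₁ (_ , refl ∷ refl ∷ ++⁺ˡ α (refl ∷ refl ∷ minimum β) , sim)
... | inj₂ sim = Avoids⇒¬Embeds av₃₂₄₁ (_ , refl ∷ refl ∷ ++⁺ˡ α (refl ∷ refl ∷ minimum β) , sim)

Sortable132-split⇒Shapes : ∀ {m} α β → Sortable132 (suc m) (α ++ suc m ∷ β) → IsPerm m (α ++ β) →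
  (∀ {a b} → a ∈ α → b ∈ β → b < a) → Shapes Sortable132 Sortable132 Sortable132 m (α ++ suc m ∷ β)
Sortable132-split⇒Shapes []      β s p _ = inj₂ (inj₁ (β , refl , Sortable132-⊆ (_ ∷ˢ ⊆-refl) p s))
Sortable132-split⇒Shapes {zero} (a ∷ α) β s p _ = ⊥-elim (¬x∷xs↭[] p)
Sortable132-split⇒Shapes {suc m} (a ∷ α) [] s p _ =
  inj₁ (a ∷ α , refl , Sortable132-⊆ (++⁺ʳ _ ⊆-refl) (subst (IsPerm (suc m)) (List.++-identityʳ (a ∷ α)) p) s)
Sortable132-split⇒Shapes {suc m} (a ∷ []) (b ∷ β) s p above = inj₂ (inj₂ (single-before-max s p (above (here refl))))
Sortable132-split⇒Shapes {suc m} (a₁ ∷ a₂ ∷ α) (b ∷ β) s p above =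
  ⊥-elim (no-two-before-max s p (above (here refl) (here refl)) (above (there (here refl)) (here refl)))

Sortable132-suc⇒ : ∀ {m w} → Sortable132 (suc m) w → Shapes Sortable132 Sortable132 Sortable132 m w
Sortable132-suc⇒ s@(p , av₁₃₂ , _) with α , β , refl ← ∈-∃++ (IsPerm-max∈ p) =
  let p′ = IsPerm-remove-max α p in
  Sortable132-split⇒Shapes α β s p′ (prefix-above-suffix α av₁₃₂ (IsPerm⇒Unique p′) (IsPerm-below p′))

Stable : List ℕ → Set
Stable σ = AppendMaxReduces σ σ × PrependMaxPreserves σ × PrependPairReduces σ σ

stable : ∀ {s₁ s₂ σ t} → ¬ All (_< t) (s₁ ∷ s₂ ∷ σ) → ¬ All (_< s₁) (σ ∷ʳ t) → Stable (s₁ ∷ s₂ ∷ σ ∷ʳ t)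
stable ¬t-max ¬s₁-max =
  appendMax-reduces-self (LastIsNotMax-∷ʳ ¬t-max) ,
  prependMax-preserves (λ s₁-max → ¬s₁-max (All.tail s₁-max)) ,
  prependPair-reduces-self ¬s₁-max

stable-132 : Stable (1 ∷ 3 ∷ 2 ∷ [])
stable-132 = stable {1} {3} {[]} {2} (from-no (All.all? (_<? 2) (1 ∷ 3 ∷ []))) (from-no (All.all? (_<? 1) (2 ∷ [])))

stable-2341 : Stable (2 ∷ 3 ∷ 4 ∷ 1 ∷ [])
stable-2341 = stable {2} {3} {4 ∷ []} {1} (from-no (All.all? (_<? 1) (2 ∷ 3 ∷ 4 ∷ []))) (from-no (All.all? (_<? 2) (4 ∷ 1 ∷ [])))

stable-3241 : Stable (3 ∷ 2 ∷ 4 ∷ 1 ∷ [])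
stable-3241 = stable {3} {2} {4 ∷ []} {1} (from-no (All.all? (_<? 1) (3 ∷ 2 ∷ 4 ∷ []))) (from-no (All.all? (_<? 3) (4 ∷ 1 ∷ [])))

Sortable132-appendMax : ∀ {n α} → Sortable132 n α → Sortable132 (suc n) (α ∷ʳ suc n)
Sortable132-appendMax (p , a₁ , a₂ , a₃) =
  IsPerm-∷ʳ p , keep stable-132 a₁ , keep stable-2341 a₂ , keep stable-3241 a₃
  where keep = λ {σ} (st : Stable σ) → from (Avoids-appendMax (proj₁ st) p)

Sortable132-prependMax : ∀ {n β} → Sortable132 n β → Sortable132 (suc n) (suc n ∷ β)
Sortable132-prependMax (p , a₁ , a₂ , a₃) =
  IsPerm-∷ p , keep stable-132 a₁ , keep stable-2341 a₂ , keep stable-3241 a₃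
  where keep = λ {σ} (st : Stable σ) → from (Avoids-prependMax (proj₁ (proj₂ st)) p)

Sortable132-prependPair : ∀ {n β} → Sortable132 n β → Sortable132 (suc (suc n)) (suc n ∷ suc (suc n) ∷ β)
Sortable132-prependPair (p , a₁ , a₂ , a₃) =
  IsPerm-∷∷ p , keep stable-132 a₁ , keep stable-2341 a₂ , keep stable-3241 a₃
  where keep = λ {σ} (st : Stable σ) → from (Avoids-prependPair (proj₂ (proj₂ st)) p)

Sortable132-suc⇐ : ∀ {m w} → Shapes Sortable132 Sortable132 Sortable132 m w → Sortable132 (suc m) w
Sortable132-suc⇐ {suc m}       (inj₁ (_ , refl , s))        = Sortable132-appendMax s
Sortable132-suc⇐               (inj₂ (inj₁ (_ , refl , s))) = Sortable132-prependMax s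
Sortable132-suc⇐ {suc (suc m)} (inj₂ (inj₂ (_ , refl , s))) = Sortable132-prependPair s

Avoiders : List ℕ → ℕ → List ℕ → Set
Avoiders σ n w = InP n σ w

module Decomposition {σ σₐ σ꜀ : List ℕ}
  (append : AppendMaxReduces σ σₐ) (prepend : PrependMaxPreserves σ) (pair : PrependPairReduces σ σ꜀) where

  Appended-InP⇔ : ∀ m {w} → (Appended Sortable132 m w × Avoids w σ) ⇔ Appended (Avoiders σₐ) m w
  Appended-InP⇔ zero    = mk⇔ (λ ()) (λ ())
  Appended-InP⇔ (suc m) = mk⇔
    (λ { ((α , refl , s) , av) → α , refl , from (InP⇔Sortable132×Avoids {τ = σₐ}) (s , to (Avoids-appendMax append (proj₁ s)) av) })
    (λ { (α , refl , i) → let (s , av) = to (InP⇔Sortable132×Avoids {τ = σₐ}) i in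
                          (α , refl , s) , from (Avoids-appendMax append (proj₁ s)) av })

  Prepended-InP⇔ : ∀ m {w} → (Prepended Sortable132 m w × Avoids w σ) ⇔ Prepended (Avoiders σ) m w
  Prepended-InP⇔ m = mk⇔
    (λ { ((β , refl , s) , av) → β , refl , from (InP⇔Sortable132×Avoids {τ = σ}) (s , to (Avoids-prependMax prepend (proj₁ s)) av) })
    (λ { (β , refl , i) → let (s , av) = to (InP⇔Sortable132×Avoids {τ = σ}) i in
                          (β , refl , s) , from (Avoids-prependMax prepend (proj₁ s)) av })

  PairPrepended-InP⇔ : ∀ m {w} → (PairPrepended Sortable132 m w × Avoids w σ) ⇔ PairPrepended (Avoiders σ꜀) m w
  PairPrepended-InP⇔ zero          = mk⇔ (λ { (() , _) }) (λ ())
  PairPrepended-InP⇔ (suc zero)    = mk⇔ (λ { (() , _) }) (λ ())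
  PairPrepended-InP⇔ (suc (suc m)) = mk⇔
    (λ { ((β , refl , s) , av) → β , refl , from (InP⇔Sortable132×Avoids {τ = σ꜀}) (s , to (Avoids-prependPair pair (proj₁ s)) av) })
    (λ { (β , refl , i) → let (s , av) = to (InP⇔Sortable132×Avoids {τ = σ꜀}) i in
                          (β , refl , s) , from (Avoids-prependPair pair (proj₁ s)) av })

  InP-suc⇔ : ∀ {m w} → InP (suc m) σ w ⇔ Shapes (Avoiders σₐ) (Avoiders σ) (Avoiders σ꜀) m w
  InP-suc⇔ {m} = mk⇔ split join
    where
    split : ∀ {w} → InP (suc m) σ w → Shapes (Avoiders σₐ) (Avoiders σ) (Avoiders σ꜀) m w
    split i with s , av ← to (InP⇔Sortable132×Avoids {τ = σ}) i =
      Sum.map (λ a → to (Appended-InP⇔ m) (a , av))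
              (Sum.map (λ b → to (Prepended-InP⇔ m) (b , av)) (λ c → to (PairPrepended-InP⇔ m) (c , av)))
              (Sortable132-suc⇒ s)
    join : ∀ {w} → Shapes (Avoiders σₐ) (Avoiders σ) (Avoiders σ꜀) m w → InP (suc m) σ w
    join shape with shape′ ← Sum.map (from (Appended-InP⇔ m)) (Sum.map (from (Prepended-InP⇔ m)) (from (PairPrepended-InP⇔ m))) shape =
      from (InP⇔Sortable132×Avoids {τ = σ})
        (Sortable132-suc⇐ (Sum.map proj₁ (Sum.map proj₁ proj₁) shape′) , [ proj₂ , [ proj₂ , proj₂ ]′ ]′ shape′)

  InP-size-shapes : ∀ {m a b c} → HasSize (Appended (Avoiders σₐ) m) a → HasSize (Prepended (Avoiders σ) m) b →
    HasSize (PairPrepended (Avoiders σ꜀) m) c → HasSize (InP (suc m) σ) (a + (b + c))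
  InP-size-shapes hA hB hC = HasSize-resp (λ _ → ⇔-sym InP-suc⇔)
    (HasSize-⊎ (λ a → [ Appended-disjoint-Prepended {Q = Avoiders σ} proj₁ a ,
                        Appended-disjoint-PairPrepended {R = Avoiders σ꜀} proj₁ proj₁ a ]′)
               hA (HasSize-⊎ (Prepended-disjoint-PairPrepended {Q = Avoiders σ} {R = Avoiders σ꜀}) hB hC))

  InP-size-1 : ∀ {b} → HasSize (InP 0 σ) b → HasSize (InP 1 σ) b
  InP-size-1 {b} hB = subst (HasSize (InP 1 σ)) (+-identityʳ b)
    (InP-size-shapes (HasSize-∅ (λ _ ())) (HasSize-image List.∷-injectiveʳ hB) (HasSize-∅ (λ _ ())))

  InP-size-2 : ∀ {a b} → HasSize (InP 1 σₐ) a → HasSize (InP 1 σ) b → HasSize (InP 2 σ) (a + b)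
  InP-size-2 {a} {b} hA hB = subst (HasSize (InP 2 σ)) (cong (a +_) (+-identityʳ b))
    (InP-size-shapes (HasSize-image (List.∷ʳ-injectiveˡ _ _) hA) (HasSize-image List.∷-injectiveʳ hB) (HasSize-∅ (λ _ ())))

  InP-size-3+ : ∀ {m a b c} → HasSize (InP (suc (suc m)) σₐ) a → HasSize (InP (suc (suc m)) σ) b →
    HasSize (InP (suc m) σ꜀) c → HasSize (InP (suc (suc (suc m))) σ) (a + (b + c))
  InP-size-3+ hA hB hC = InP-size-shapes (HasSize-image (List.∷ʳ-injectiveˡ _ _) hA) (HasSize-image List.∷-injectiveʳ hB)
    (HasSize-image (λ e → List.∷-injectiveʳ (List.∷-injectiveʳ e)) hC)

-- Counting the avoiders of 12…k and of τ k

Avoids-[] : ∀ {s σ} → Avoids [] (s ∷ σ)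
Avoids-[] ([] , [] , () , _)

InP-zero-size : ∀ {s σ} → HasSize (InP 0 (s ∷ σ)) 1
InP-zero-size = HasSize-singleton []
  λ w → mk⇔ (λ i → ↭-empty-inv (proj₁ i)) (λ { refl → ↭-refl , Avoids-[] , Avoids-[] , Avoids-[] , Avoids-[] })

InP-[]-size : ∀ {n} → HasSize (InP n []) 0
InP-[]-size = HasSize-∅ λ w (_ , _ , _ , _ , av) → av (from Contains⇔Embeds (Embeds-[] w))

InP-suc-[1]-size : ∀ {n} → HasSize (InP (suc n) (1 ∷ [])) 0
InP-suc-[1]-size = HasSize-∅ λ { [] (p , _) → IsPerm-nonempty p
                         ; (_ ∷ _) (_ , _ , _ , _ , av) → av (from Contains⇔Embeds Embeds-singleton) }

[1⋯]-appendMax : ∀ k → AppendMaxReduces [1⋯ suc k ] [1⋯ k ]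
[1⋯]-appendMax k = subst (λ σ → AppendMaxReduces σ [1⋯ k ]) (sym ([1⋯]-∷ʳ k)) (appendMax-reduces-init (IsPerm-below ↭-refl))

[1⋯]-prependMax : ∀ k → PrependMaxPreserves [1⋯ suc (suc k) ]
[1⋯]-prependMax k = prependMax-preserves λ { (s≤s () ∷ _) }

-- What avoiding 12…(k+2) asks of β in m (m+1) β: the same pattern, except for k = 0,
-- where m (m+1) is itself an occurrence of 12.
pairReduct : ℕ → ℕ
pairReduct zero    = zero
pairReduct (suc k) = suc (suc (suc k))

[1⋯]-prependPair : ∀ k → PrependPairReduces [1⋯ suc (suc k) ] [1⋯ pairReduct k ]
[1⋯]-prependPair zero    = prependPair-reduces-12
[1⋯]-prependPair (suc k) = prependPair-reduces-self λ { (s≤s () ∷ _) }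

module [1⋯]-Decomposition (k : ℕ) = Decomposition ([1⋯]-appendMax (suc k)) ([1⋯]-prependMax k) ([1⋯]-prependPair k)

incCount : ℕ → ℕ → ℕ
incCount zero          _                   = 0
incCount (suc zero)    zero                = 1
incCount (suc zero)    (suc _)             = 0
incCount (suc (suc k)) zero                = 1
incCount (suc (suc k)) (suc zero)          = 1
incCount (suc (suc k)) (suc (suc zero))    = incCount (suc k) 1 + 1
incCount (suc (suc k)) (suc (suc (suc m))) =
  incCount (suc k) (suc (suc m)) + (incCount (suc (suc k)) (suc (suc m)) + incCount (pairReduct k) (suc m))

[1⋯]-avoiders-size : ∀ k n → HasSize (InP n [1⋯ k ]) (incCount k n)
[1⋯]-avoiders-size zero          n                   = InP-[]-size
[1⋯]-avoiders-size (suc zero)    zero                = InP-zero-size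
[1⋯]-avoiders-size (suc zero)    (suc n)             = InP-suc-[1]-size
[1⋯]-avoiders-size (suc (suc k)) zero                = InP-zero-size
[1⋯]-avoiders-size (suc (suc k)) (suc zero)          = [1⋯]-Decomposition.InP-size-1 k InP-zero-size
[1⋯]-avoiders-size (suc (suc k)) (suc (suc zero))    =
  [1⋯]-Decomposition.InP-size-2 k ([1⋯]-avoiders-size (suc k) 1) ([1⋯]-avoiders-size (suc (suc k)) 1)
[1⋯]-avoiders-size (suc (suc k)) (suc (suc (suc m))) =
  [1⋯]-Decomposition.InP-size-3+ k ([1⋯]-avoiders-size (suc k) (suc (suc m)))
    ([1⋯]-avoiders-size (suc (suc k)) (suc (suc m))) ([1⋯]-avoiders-size (pairReduct k) (suc m))

-- τ 2, τ 3 and τ 4 compute to 3412, 45123 and 561234.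
τ : ℕ → List ℕ
τ k = suc k ∷ suc (suc k) ∷ [1⋯ k ]

τ-appendMax : ∀ k → AppendMaxReduces (τ (suc k)) (τ (suc k))
τ-appendMax k = appendMax-reduces-self
  (subst LastIsNotMax (cong (λ l → suc (suc k) ∷ suc (suc (suc k)) ∷ l) (sym ([1⋯]-∷ʳ k)))
         (LastIsNotMax-∷ʳ {suc (suc k) ∷ suc (suc (suc k)) ∷ [1⋯ k ]} λ { (head<last ∷ _) → <-asym (n<1+n _) head<last }))

τ-prependMax : ∀ k → PrependMaxPreserves (τ k)
τ-prependMax k = prependMax-preserves λ { (second<head ∷ _) → <-asym (n<1+n _) second<head }

τ-prependPair : ∀ k → PrependPairReduces (τ k) [1⋯ k ]
τ-prependPair k = prependPair-reduces-tail (n<1+n (suc k)) (IsPerm-below ↭-refl)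

module τ-Decomposition (k : ℕ) = Decomposition (τ-appendMax k) (τ-prependMax (suc k)) (τ-prependPair (suc k))

τCount : ℕ → ℕ → ℕ
τCount k zero                = 1
τCount k (suc zero)          = 1
τCount k (suc (suc zero))    = τCount k 1 + τCount k 1
τCount k (suc (suc (suc m))) = τCount k (suc (suc m)) + (τCount k (suc (suc m)) + incCount k (suc m))

τ-avoiders-size : ∀ k n → HasSize (InP n (τ (suc k))) (τCount (suc k) n)
τ-avoiders-size k zero                = InP-zero-size
τ-avoiders-size k (suc zero)          = τ-Decomposition.InP-size-1 k InP-zero-size
τ-avoiders-size k (suc (suc zero))    = τ-Decomposition.InP-size-2 k (τ-avoiders-size k 1) (τ-avoiders-size k 1)
τ-avoiders-size k (suc (suc (suc m))) = τ-Decomposition.InP-size-3+ k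
  (τ-avoiders-size k (suc (suc m))) (τ-avoiders-size k (suc (suc m))) ([1⋯]-avoiders-size (suc k) (suc m))

-- Closed forms of the counts

open ≡-Reasoning

incCount-12 : ∀ n → incCount 2 n ≡ 1
incCount-12 zero                = refl
incCount-12 (suc zero)          = refl
incCount-12 (suc (suc zero))    = refl
incCount-12 (suc (suc (suc m))) = trans (+-identityʳ _) (incCount-12 (suc (suc m)))

fibonacci-regroup : ∀ x y → 1 + (x + y) + 1 ≡ (x + 1) + (y + 1)
fibonacci-regroup = solve-∀

incCount-123 : ∀ n → incCount 3 (suc n) + 1 ≡ F (3 + n)
incCount-123 zero          = refl
incCount-123 (suc zero)    = refl
incCount-123 (suc (suc m)) = begin
  incCount 2 (2 + m) + (x + y) + 1 ≡⟨ cong (λ e → e + (x + y) + 1) (incCount-12 (2 + m)) ⟩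
  1 + (x + y) + 1                  ≡⟨ fibonacci-regroup x y ⟩
  (x + 1) + (y + 1)                ≡⟨ cong₂ _+_ (incCount-123 (suc m)) (incCount-123 m) ⟩
  F (4 + m) + F (3 + m)            ∎
  where
  x = incCount 3 (2 + m)
  y = incCount 3 (1 + m)

-- The step lemmas below add a common term to both sides, so that the hypotheses can be
-- substituted without truncated subtraction. Where p = F (j + 1) and q = F j, the names
-- f₂, f₃, … stand for F (j + 2), F (j + 3), …, so the Fibonacci recurrence holds by computation.
incCount-1234-expand : ∀ x y z p q → let f₂ = p + q ; f₃ = f₂ + p ; f₄ = f₃ + f₂ in
  5 * (x + (y + z)) + 5 * f₄ + (5 + 5 * f₃ + 5 * f₂) ≡ 5 * (x + 1) + (5 * y + 5 * f₃) + (5 * z + 5 * f₂) + 5 * f₄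
incCount-1234-expand = solve-∀

incCount-1234-collect : ∀ j p q → let f₂ = p + q ; f₃ = f₂ + p ; f₄ = f₃ + f₂ in
  5 * f₄ + ((3 + j) * f₂ + 3 * (2 + j) * f₃ + 5) + ((2 + j) * p + 3 * (1 + j) * f₂ + 5) + 5 * f₄
    ≡ (4 + j) * f₃ + 3 * (3 + j) * f₄ + 5 + (5 + 5 * f₃ + 5 * f₂)
incCount-1234-collect = solve-∀

incCount-1234-step : ∀ x y z j p q → let f₂ = p + q ; f₃ = f₂ + p ; f₄ = f₃ + f₂ in
  x + 1 ≡ f₄ →
  5 * y + 5 * f₃ ≡ (3 + j) * f₂ + 3 * (2 + j) * f₃ + 5 →
  5 * z + 5 * f₂ ≡ (2 + j) * p + 3 * (1 + j) * f₂ + 5 →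
  5 * (x + (y + z)) + 5 * f₄ ≡ (4 + j) * f₃ + 3 * (3 + j) * f₄ + 5
incCount-1234-step x y z j p q hx hy hz =
  let f₂ = p + q ; f₃ = f₂ + p ; f₄ = f₃ + f₂ in
  +-cancelʳ-≡ (5 + 5 * f₃ + 5 * f₂) _ _ (begin
    _ ≡⟨ incCount-1234-expand x y z p q ⟩
    _ ≡⟨ cong₂ (λ b c → 5 * (x + 1) + b + c + 5 * f₄) hy hz ⟩
    _ ≡⟨ cong (λ a → 5 * a + ((3 + j) * f₂ + 3 * (2 + j) * f₃ + 5) + ((2 + j) * p + 3 * (1 + j) * f₂ + 5) + 5 * f₄) hx ⟩
    _ ≡⟨ incCount-1234-collect j p q ⟩
    _ ∎)

incCount-1234 : ∀ n → 5 * incCount 4 (suc n) + 5 * F (2 + n) ≡ (2 + n) * F (1 + n) + 3 * (1 + n) * F (2 + n) + 5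
incCount-1234 zero          = refl
incCount-1234 (suc zero)    = refl
incCount-1234 (suc (suc m)) =
  incCount-1234-step (incCount 3 (2 + m)) (incCount 4 (2 + m)) (incCount 4 (1 + m)) m (F (suc m)) (F m)
  (incCount-123 (suc m)) (incCount-1234 (suc m)) (incCount-1234 m)

doubling-regroup : ∀ t → t + (t + 1) + 1 ≡ 2 * (t + 1)
doubling-regroup = solve-∀

τCount-2-closed : ∀ k → τCount 2 (2 + k) + 1 ≡ 3 * 2 ^ k
τCount-2-closed zero    = refl
τCount-2-closed (suc m) = begin
  t + (t + incCount 2 (1 + m)) + 1 ≡⟨ cong (λ e → t + (t + e) + 1) (incCount-12 (1 + m)) ⟩
  t + (t + 1) + 1                  ≡⟨ doubling-regroup t ⟩
  2 * (t + 1)                      ≡⟨ cong (2 *_) (τCount-2-closed m) ⟩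
  2 * (3 * 2 ^ m)                  ≡⟨ trans (sym (*-assoc 2 3 (2 ^ m))) (*-assoc 3 2 (2 ^ m)) ⟩
  3 * (2 * 2 ^ m)                  ∎
  where t = τCount 2 (2 + m)

τCount-3-expand : ∀ t e a b → t + (t + e) + ((b + a) + b) + (1 + a) ≡ 2 * (t + (b + a)) + (e + 1)
τCount-3-expand = solve-∀

τCount-3-collect : ∀ a P → 2 * (3 * (2 * P) + 1) + a ≡ 3 * (2 * (2 * P)) + 1 + (1 + a)
τCount-3-collect = solve-∀

τCount-3-step : ∀ t e a b P → t + (b + a) ≡ 3 * (2 * P) + 1 → e + 1 ≡ a →
  t + (t + e) + ((b + a) + b) ≡ 3 * (2 * (2 * P)) + 1
τCount-3-step t e a b P ht he = +-cancelʳ-≡ (1 + a) _ _ (begin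
  _ ≡⟨ τCount-3-expand t e a b ⟩
  _ ≡⟨ cong₂ (λ u v → 2 * u + v) ht he ⟩
  _ ≡⟨ τCount-3-collect a P ⟩
  _ ∎)

τCount-3-closed : ∀ k → τCount 3 (1 + k) + F (4 + k) ≡ 3 * 2 ^ k + 1
τCount-3-closed zero          = refl
τCount-3-closed (suc zero)    = refl
τCount-3-closed (suc (suc m)) =
  τCount-3-step (τCount 3 (2 + m)) (incCount 3 (1 + m)) (F (3 + m)) (F (4 + m)) (2 ^ m) (τCount-3-closed (suc m)) (incCount-123 m)

τCount-4-expand : ∀ t e j p q → let f₂ = p + q ; f₃ = f₂ + p ; f₄ = f₃ + f₂ ; f₅ = f₄ + f₃ ; f₆ = f₅ + f₄ ; f₇ = f₆ + f₅ in
  5 * (t + (t + e)) + 6 * f₄ + (4 + j) * (f₇ + f₅) + 5 + (2 * (6 * f₃ + (3 + j) * (f₆ + f₄) + 5) + 5 * f₂)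
    ≡ 2 * (5 * t + 6 * f₃ + (3 + j) * (f₆ + f₄) + 5) + (5 * e + 5 * f₂) + (6 * f₄ + (4 + j) * (f₇ + f₅) + 5)
τCount-4-expand = solve-∀

τCount-4-collect : ∀ j p q P → let f₂ = p + q ; f₃ = f₂ + p ; f₄ = f₃ + f₂ ; f₅ = f₄ + f₃ ; f₆ = f₅ + f₄ ; f₇ = f₆ + f₅ in
  2 * (15 * (2 * (2 * P))) + ((2 + j) * p + 3 * (1 + j) * f₂ + 5) + (6 * f₄ + (4 + j) * (f₇ + f₅) + 5)
    ≡ 15 * (2 * (2 * (2 * P))) + (2 * (6 * f₃ + (3 + j) * (f₆ + f₄) + 5) + 5 * f₂)
τCount-4-collect = solve-∀

τCount-4-step : ∀ t e j p q P → let f₂ = p + q ; f₃ = f₂ + p ; f₄ = f₃ + f₂ ; f₅ = f₄ + f₃ ; f₆ = f₅ + f₄ ; f₇ = f₆ + f₅ in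
  5 * t + 6 * f₃ + (3 + j) * (f₆ + f₄) + 5 ≡ 15 * (2 * (2 * P)) →
  5 * e + 5 * f₂ ≡ (2 + j) * p + 3 * (1 + j) * f₂ + 5 →
  5 * (t + (t + e)) + 6 * f₄ + (4 + j) * (f₇ + f₅) + 5 ≡ 15 * (2 * (2 * (2 * P)))
τCount-4-step t e j p q P ht he =
  let f₂ = p + q ; f₃ = f₂ + p ; f₄ = f₃ + f₂ ; f₅ = f₄ + f₃ ; f₆ = f₅ + f₄ ; f₇ = f₆ + f₅ in
  +-cancelʳ-≡ (2 * (6 * f₃ + (3 + j) * (f₆ + f₄) + 5) + 5 * f₂) _ _ (begin
    _ ≡⟨ τCount-4-expand t e j p q ⟩
    _ ≡⟨ cong₂ (λ u v → 2 * u + v + (6 * f₄ + (4 + j) * (f₇ + f₅) + 5)) ht he ⟩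
    _ ≡⟨ τCount-4-collect j p q P ⟩
    _ ∎)

τCount-4-closed : ∀ k → 5 * τCount 4 (1 + k) + 6 * F (2 + k) + (2 + k) * (F (5 + k) + F (3 + k)) + 5 ≡ 15 * 2 ^ (1 + k)
τCount-4-closed zero          = refl
τCount-4-closed (suc zero)    = refl
τCount-4-closed (suc (suc m)) =
  τCount-4-step (τCount 4 (2 + m)) (incCount 4 (1 + m)) m (F (suc m)) (F m) (2 ^ m) (τCount-4-closed (suc m)) (incCount-1234 m)

τCount-3412 : ∀ n → 2 ≤ n → τCount 2 n ≡ 3 * 2 ^ (n ∸ 2) ∸ 1
τCount-3412 (suc zero)    (s≤s ())
τCount-3412 (suc (suc k)) _ = begin
  τCount 2 (2 + k)         ≡⟨ sym (m+n∸n≡m _ 1) ⟩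
  τCount 2 (2 + k) + 1 ∸ 1 ≡⟨ cong (_∸ 1) (τCount-2-closed k) ⟩
  3 * 2 ^ k ∸ 1            ∎

τCount-45123 : ∀ n → 1 ≤ n → τCount 3 n ≡ (3 * 2 ^ (n ∸ 1) + 1) ∸ F (n + 3)
τCount-45123 (suc k) _ = begin
  τCount 3 (1 + k)                         ≡⟨ sym (m+n∸n≡m _ (F (4 + k))) ⟩
  τCount 3 (1 + k) + F (4 + k) ∸ F (4 + k) ≡⟨ cong₂ _∸_ (τCount-3-closed k) (cong F (+-comm 3 (suc k))) ⟩
  (3 * 2 ^ k + 1) ∸ F (suc k + 3)          ∎

τCount-561234 : ∀ n → 1 ≤ n →
  5 * τCount 4 n + 6 * F (n + 1) + (n + 1) * (F (n + 4) + F (n + 2)) ≡ 5 * (3 * 2 ^ n ∸ 1)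
τCount-561234 (suc k) _ rewrite +-comm k 1 | +-comm k 2 | +-comm k 4 = begin
  X                                 ≡⟨ sym (m+n∸n≡m X 5) ⟩
  X + 5 ∸ 5                         ≡⟨ cong (_∸ 5) (τCount-4-closed k) ⟩
  15 * 2 ^ (1 + k) ∸ 5              ≡⟨ cong (_∸ 5) (*-assoc 5 3 (2 ^ (1 + k))) ⟩
  5 * (3 * 2 ^ (1 + k)) ∸ 5 * 1     ≡⟨ sym (*-distribˡ-∸ 5 (3 * 2 ^ (1 + k)) 1) ⟩
  5 * (3 * 2 ^ (1 + k) ∸ 1)         ∎
  where X = 5 * τCount 4 (1 + k) + 6 * F (2 + k) + (2 + k) * (F (5 + k) + F (3 + k))

mainTheorem8 :
    (∀ n → 2 ≤ n → HasSize (InP n (3 ∷ 4 ∷ 1 ∷ 2 ∷ [])) (3 * 2 ^ (n ∸ 2) ∸ 1))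
    × (∀ n → 1 ≤ n → HasSize (InP n (4 ∷ 5 ∷ 1 ∷ 2 ∷ 3 ∷ [])) ((3 * 2 ^ (n ∸ 1) + 1) ∸ F (n + 3)))
    × (∀ n → 1 ≤ n → ∃[ k ] (HasSize (InP n (5 ∷ 6 ∷ 1 ∷ 2 ∷ 3 ∷ 4 ∷ [])) k
          × 5 * k + 6 * F (n + 1) + (n + 1) * (F (n + 4) + F (n + 2)) ≡ 5 * (3 * 2 ^ n ∸ 1)))
mainTheorem8 =
  (λ n 2≤n → subst (HasSize _) (τCount-3412 n 2≤n) (τ-avoiders-size 1 n)) ,
  (λ n 1≤n → subst (HasSize _) (τCount-45123 n 1≤n) (τ-avoiders-size 2 n)) ,
  (λ n 1≤n → τCount 4 n , τ-avoiders-size 3 n , τCount-561234 n 1≤n)
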